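{- Let $H(V,E)$ be an $r$-uniform hypergraph without isolated vertices, having $n$ vertices and $m$ hyperedges. If $r>\lfloor n/2\rfloor$, then the total edge-domatic number of $H$ is $ed_t(H)=\lfloor m/2\rfloor$.
   Context: A hypergraph $H(V,E)$ has a finite vertex set $V$ and a set $E$ of hyperedges, each a subset of $V$; it is $r$-uniform if every hyperedge has exactly $r$ vertices. A vertex is isolated if it lies in no hyperedge. Two distinct hyperedges are adjacent if they share at least one vertex; a hyperedge is not adjacent to itself. A total edge-dominating set is a subset $E_t\subseteq E$ such that every hyperedge in $E$ is adjacent to some hyperedge in $E_t$. The total edge-domatic number $ed_t(H)$ is the maximum number of classes in a partition of $E$ into total edge-dominating sets. -}

module Defs where

open import Data.Nat using (ℕ; _≤_; _>_; _/_)
open import Data.Fin using (Fin)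
open import Data.Fin.Subset using (Subset; _∈_; ∣_∣)
open import Data.Product using (Σ; ∃; _×_; _,_)
open import Data.Sum using (_⊎_)
open import Relation.Binary.PropositionalEquality using (_≡_; _≢_)
open import Function.Definitions using (Injective)

-- A hypergraph H(V,E) with V = Fin n and E = {edge i | i : Fin m},
-- the hyperedges being pairwise distinct subsets of V (E is a set).
record Hypergraph (n m : ℕ) : Set where
  field
    edge     : Fin m → Subset n
    edge-inj : Injective _≡_ _≡_ edge

open Hypergraph public

module _ {n m : ℕ} (H : Hypergraph n m) where

  Uniform : ℕ → Set
  Uniform r = ∀ i → ∣ edge H i ∣ ≡ r

  Isolated : Fin n → Set
  Isolated v = ∀ i → Data.Fin.Subset._∉_ v (edge H i)

  NoIsolated : Set
  NoIsolated = ∀ v → ∃ λ i → v ∈ edge H i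

  Adjacent : Fin m → Fin m → Set
  Adjacent i j = i ≢ j × ∃ λ v → v ∈ edge H i × v ∈ edge H j

  TotalEdgeDominating : (Fin m → Set) → Set
  TotalEdgeDominating Et = ∀ e → ∃ λ f → Et f × Adjacent e f

  -- a partition of E into k (nonempty) classes, each total edge-dominating;
  -- class c i is the class of hyperedge i
  TEDPartition : ℕ → Set
  TEDPartition k = Σ (Fin m → Fin k) λ c →
      (∀ j → ∃ λ i → c i ≡ j)
    × (∀ j → TotalEdgeDominating (λ i → c i ≡ j))

  -- ed_t(H) = k : k is the maximum number of classes of such a partition
  -- (with the convention ed_t(H) = 0 if no such partition exists)
  IsTotalEdgeDomaticNumber : ℕ → Set
  IsTotalEdgeDomaticNumber k =
      (TEDPartition k ⊎ k ≡ 0)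
    × (∀ k′ → TEDPartition k′ → k′ ≤ k)

-- Every class of a total edge-dominating partition contains a hyperedge together
-- with a distinct hyperedge adjacent to it, so a partition into k classes needs
-- 2k ≤ m. Conversely, when 2r > n any two r-sets of vertices meet, so any two
-- distinct hyperedges are adjacent, and every partition all of whose classes have
-- two hyperedges is total edge-dominating; the residues modulo ⌊m/2⌋ give one.
module Submission where

open import Defs
open import Data.Nat using (ℕ; zero; suc; _+_; _*_; _≤_; _<_; _>_; _/_; _%_; NonZero; >-nonZero⁻¹; s<s⁻¹)
open import Data.Nat.Properties
  using (≰⇒>; <⇒≱; <⇒≤; <⇒≢; ≤-trans; ≤-<-trans; +-suc; *-comm; +-identityʳ; +-monoˡ-<;
         m≤m+n; m<m+n; module ≤-Reasoning)
open import Data.Nat.DivMod using (_mod_; m*n/n≡m; /-monoˡ-≤; m/n*n≤m; m<n⇒m%n≡m; [m+n]%n≡m%n)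
open import Data.Fin using (Fin; toℕ; fromℕ<; remQuot; combine; _≟_)
open import Data.Fin.Patterns using (0F; 1F)
open import Data.Fin.Properties using (toℕ-fromℕ<; toℕ-injective; toℕ<n; 0≢1+n; injective⇒≤; combine-remQuot)
open import Data.Fin.Subset using (Subset; inside; outside; ∣_∣; _∩_; Nonempty)
open import Data.Fin.Subset.Properties using (x∈p∩q⁻)
open import Data.Vec.Base using ([]; _∷_; here; there)
open import Data.Product using (Σ; _×_; _,_; proj₁; proj₂; uncurry)
open import Function.Base using (_∘_)
open import Function.Definitions using (Injective)
open import Data.Sum using (_⊎_; inj₁; inj₂)
open import Relation.Nullary using (yes; no; contradiction)
open import Relation.Binary.PropositionalEquality
  using (_≡_; _≢_; refl; sym; trans; cong; cong₂; subst; module ≡-Reasoning)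

∷-nonempty : ∀ {n} {p : Subset n} x → Nonempty p → Nonempty (x ∷ p)
∷-nonempty _ (v , v∈p) = Data.Fin.suc v , there v∈p

n<∣p∣+∣q∣⇒p∩q≢∅ : ∀ {n} (p q : Subset n) → n < ∣ p ∣ + ∣ q ∣ → Nonempty (p ∩ q)
n<∣p∣+∣q∣⇒p∩q≢∅ [] [] ()
n<∣p∣+∣q∣⇒p∩q≢∅ (inside ∷ p) (inside ∷ q) _ = 0F , here
n<∣p∣+∣q∣⇒p∩q≢∅ (inside ∷ p) (outside ∷ q) n<s =
  ∷-nonempty _ (n<∣p∣+∣q∣⇒p∩q≢∅ p q (s<s⁻¹ n<s))
n<∣p∣+∣q∣⇒p∩q≢∅ {suc n} (outside ∷ p) (inside ∷ q) n<s =
  ∷-nonempty _ (n<∣p∣+∣q∣⇒p∩q≢∅ p q (s<s⁻¹ (subst (suc n <_) (+-suc ∣ p ∣ ∣ q ∣) n<s)))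
n<∣p∣+∣q∣⇒p∩q≢∅ (outside ∷ p) (outside ∷ q) n<s =
  ∷-nonempty _ (n<∣p∣+∣q∣⇒p∩q≢∅ p q (<⇒≤ n<s))

m/d<n⇒m<n*d : ∀ {m n} d .{{_ : NonZero d}} → m / d < n → m < n * d
m/d<n⇒m<n*d {m} {n} d m/d<n = ≰⇒> λ n*d≤m → <⇒≱ m/d<n (begin
  n         ≡⟨ sym (m*n/n≡m n d) ⟩
  n * d / d ≤⟨ /-monoˡ-≤ d n*d≤m ⟩
  m / d     ∎)
  where open ≤-Reasoning

m*d≤n⇒m≤n/d : ∀ {m n} d .{{_ : NonZero d}} → m * d ≤ n → m ≤ n / d
m*d≤n⇒m≤n/d {m} {n} d m*d≤n = subst (_≤ n / d) (m*n/n≡m m d) (/-monoˡ-≤ d m*d≤n)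

LargeFibre : ∀ {m k} → ℕ → (Fin m → Fin k) → Fin k → Set
LargeFibre {m} t c j = Σ (Fin t → Fin m) λ f → Injective _≡_ _≡_ f × (∀ b → c (f b) ≡ j)

LargeFibres : ∀ {m k} → ℕ → (Fin m → Fin k) → Set
LargeFibres t c = ∀ j → LargeFibre t c j

largeFibres⇒k*t≤m : ∀ {m k} t (c : Fin m → Fin k) → LargeFibres t c → k * t ≤ m
largeFibres⇒k*t≤m {m} {k} t c large = injective⇒≤ (λ eq → remQuot-injective (pick-injective eq))
  where
  pick : Fin k × Fin t → Fin m
  pick (j , b) = proj₁ (large j) b
  pick-class : ∀ p → c (pick p) ≡ proj₁ p
  pick-class (j , b) = proj₂ (proj₂ (large j)) b
  pick-injective : ∀ {p q} → pick p ≡ pick q → p ≡ q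
  pick-injective {p} {q} eq with trans (sym (pick-class p)) (trans (cong c eq) (pick-class q))
  pick-injective {j , _} {.j , _} eq | refl = cong (j ,_) (proj₁ (proj₂ (large j)) eq)
  remQuot-injective : ∀ {i i′ : Fin (k * t)} → remQuot {k} t i ≡ remQuot t i′ → i ≡ i′
  remQuot-injective {i} {i′} eq =
    trans (sym (combine-remQuot {k} t i)) (trans (cong (uncurry combine) eq) (combine-remQuot {k} t i′))

pair : ∀ {a} {A : Set a} → A → A → Fin 2 → A
pair x y 0F = x
pair x y 1F = y

pair-injective : ∀ {a} {A : Set a} {x y : A} → x ≢ y → Injective _≡_ _≡_ (pair x y)
pair-injective x≢y {0F} {0F} _  = refl
pair-injective x≢y {0F} {1F} eq = contradiction eq x≢y
pair-injective x≢y {1F} {0F} eq = contradiction (sym eq) x≢y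
pair-injective x≢y {1F} {1F} _  = refl

pair-largeFibre : ∀ {m k} (c : Fin m → Fin k) {j x y} → x ≢ y → c x ≡ j → c y ≡ j → LargeFibre 2 c j
pair-largeFibre c x≢y cx cy = pair _ _ , pair-injective x≢y , λ { 0F → cx ; 1F → cy }

residueClass : ∀ {m} k .{{_ : NonZero k}} → Fin m → Fin k
residueClass k i = toℕ i mod k

residueClass-fromℕ< : ∀ {a m} k .{{_ : NonZero k}} (a<m : a < m) {j : Fin k} →
                      a % k ≡ toℕ j → residueClass k (fromℕ< a<m) ≡ j
residueClass-fromℕ< {a} k a<m {j} a%k≡j = toℕ-injective (begin
  toℕ (toℕ (fromℕ< a<m) mod k) ≡⟨ toℕ-fromℕ< _ ⟩
  toℕ (fromℕ< a<m) % k         ≡⟨ cong (_% k) (toℕ-fromℕ< a<m) ⟩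
  a % k                        ≡⟨ a%k≡j ⟩
  toℕ j                        ∎)
  where open ≡-Reasoning

n*2≡n+n : ∀ n → n * 2 ≡ n + n
n*2≡n+n n = trans (*-comm n 2) (cong (n +_) (+-identityʳ n))

-- Class j contains the edges j and j + k.
residueClass-largeFibres : ∀ {m} k .{{_ : NonZero k}} → k * 2 ≤ m → LargeFibres 2 (residueClass {m} k)
residueClass-largeFibres {m} k k*2≤m j = pair-largeFibre (residueClass k) x≢y
  (residueClass-fromℕ< k j<m (m<n⇒m%n≡m (toℕ<n j)))
  (residueClass-fromℕ< k j+k<m (trans ([m+n]%n≡m%n (toℕ j) k) (m<n⇒m%n≡m (toℕ<n j))))
  where
  j+k<m : toℕ j + k < m
  j+k<m = ≤-trans (+-monoˡ-< k (toℕ<n j)) (subst (_≤ m) (n*2≡n+n k) k*2≤m)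
  j<m : toℕ j < m
  j<m = ≤-<-trans (m≤m+n (toℕ j) k) j+k<m
  x≢y : fromℕ< j<m ≢ fromℕ< j+k<m
  x≢y eq = <⇒≢ (m<m+n (toℕ j) (>-nonZero⁻¹ k))
    (trans (sym (toℕ-fromℕ< j<m)) (trans (cong toℕ eq) (toℕ-fromℕ< j+k<m)))

module _ {n m : ℕ} (H : Hypergraph n m) where

  Intersecting : Set
  Intersecting = ∀ i j → Nonempty (edge H i ∩ edge H j)

  uniform⇒intersecting : ∀ {r} → Uniform H r → n < r * 2 → Intersecting
  uniform⇒intersecting {r} uniform n<r*2 i j = n<∣p∣+∣q∣⇒p∩q≢∅ (edge H i) (edge H j) (begin-strict
    n                           <⟨ n<r*2 ⟩
    r * 2                       ≡⟨ n*2≡n+n r ⟩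
    r + r                       ≡⟨ cong₂ _+_ (uniform i) (uniform j) ⟨
    ∣ edge H i ∣ + ∣ edge H j ∣ ∎)
    where open ≤-Reasoning

  tedPartition⇒largeFibres : ∀ {k} (P : TEDPartition H k) → LargeFibres 2 (proj₁ P)
  tedPartition⇒largeFibres (c , covers , dominating) j =
    let (i , ci≡j)           = covers j
        (f , cf≡j , i≢f , _) = dominating j i
    in pair-largeFibre c i≢f ci≡j cf≡j

  tedPartition⇒k*2≤m : ∀ {k} → TEDPartition H k → k * 2 ≤ m
  tedPartition⇒k*2≤m P = largeFibres⇒k*t≤m 2 (proj₁ P) (tedPartition⇒largeFibres P)

  intersecting⇒adjacent : Intersecting → ∀ {i j} → i ≢ j → Adjacent H i j
  intersecting⇒adjacent meet {i} {j} i≢j =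
    let (v , v∈ei∩ej) = meet i j in i≢j , v , x∈p∩q⁻ (edge H i) (edge H j) v∈ei∩ej

  largeFibres⇒tedPartition : Intersecting → ∀ {k} (c : Fin m → Fin k) → LargeFibres 2 c → TEDPartition H k
  largeFibres⇒tedPartition meet c large = c , (λ j → proj₁ (large j) 0F , proj₂ (proj₂ (large j)) 0F) , dominating
    where
    dominating : ∀ j → TotalEdgeDominating H (λ i → c i ≡ j)
    dominating j e with (f , f-injective , cf≡j) ← large j | e ≟ f 0F
    ... | yes refl = f 1F , cf≡j 1F , intersecting⇒adjacent meet (0≢1+n ∘ f-injective)
    ... | no e≢f0  = f 0F , cf≡j 0F , intersecting⇒adjacent meet e≢f0

  intersecting⇒tedPartition : Intersecting → ∀ k → k * 2 ≤ m → TEDPartition H k ⊎ k ≡ 0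
  intersecting⇒tedPartition meet zero      _     = inj₂ refl
  intersecting⇒tedPartition meet k@(suc _) k*2≤m =
    inj₁ (largeFibres⇒tedPartition meet (residueClass k) (residueClass-largeFibres k k*2≤m))

lemma8 : (n m r : ℕ) (H : Hypergraph n m) →
    Uniform H r → NoIsolated H → r > n / 2 →
    IsTotalEdgeDomaticNumber H (m / 2)
lemma8 n m r H uniform _ n/2<r =
    intersecting⇒tedPartition H meet (m / 2) (m/n*n≤m m 2)
  , λ k P → m*d≤n⇒m≤n/d 2 (tedPartition⇒k*2≤m H P)
  where
  meet : Intersecting H
  meet = uniform⇒intersecting H uniform (m/d<n⇒m<n*d 2 n/2<r)
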